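{- Let $\mathcal{F}$ be a non-principal filter on $\omega$ and let $\mathcal{F}^c=\{X\subseteq\omega : \omega\setminus X\in\mathcal{F}\}$. Then $\mathcal{F}+\mathcal{F}=\mathcal{F}^c$, where $\mathcal{F}+\mathcal{F}=\{X+Y : X,Y\in\mathcal{F}\}$.
   Context: Subsets of $\omega$ are identified with their characteristic functions in $2^\omega$, and $X+Y$ denotes coordinatewise addition modulo 2 of the characteristic functions (equivalently, the symmetric difference of $X$ and $Y$). -}

module Defs where

open import Data.Nat using (ℕ; _≤_)
open import Data.Bool using (Bool; true; false; _xor_; not; _∧_)
open import Data.Product using (Σ; ∃; _×_)
open import Relation.Nullary using (¬_)
open import Relation.Binary.PropositionalEquality using (_≡_)

Subset : Set
Subset = ℕ → Bool

ω : Subset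
ω _ = true

∅ : Subset
∅ _ = false

∁ : Subset → Subset
∁ X n = not (X n)

_∩_ : Subset → Subset → Subset
(X ∩ Y) n = X n ∧ Y n

-- X + Y : coordinatewise addition mod 2 (symmetric difference).
_⊕_ : Subset → Subset → Subset
(X ⊕ Y) n = X n xor Y n

_⊆_ : Subset → Subset → Set
X ⊆ Y = ∀ n → X n ≡ true → Y n ≡ true

_≐_ : Subset → Subset → Set
X ≐ Y = ∀ n → X n ≡ Y n

Cofinite : Subset → Set
Cofinite X = ∃ λ N → ∀ n → N ≤ n → X n ≡ true

record IsFilter (F : Subset → Set) : Set where
  field
    has-ω      : F ω
    proper     : ¬ F ∅
    upward     : ∀ X Y → X ⊆ Y → F X → F Y
    intersect  : ∀ X Y → F X → F Y → F (X ∩ Y)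

NonPrincipal : (Subset → Set) → Set
NonPrincipal F = ∀ X → Cofinite X → F X

Dual : (Subset → Set) → Subset → Set
Dual F X = F (∁ X)

SumSet : (Subset → Set) → Subset → Set
SumSet F Z = Σ Subset λ X → Σ Subset λ Y → F X × F Y × (Z ≐ (X ⊕ Y))

-- Since X ∩ Y is disjoint from X + Y, the set ω ∖ (X + Y) lies above X ∩ Y ∈ F,
-- which gives F + F ⊆ F^c; conversely Z = ω + (ω ∖ Z) with both summands in F
-- when Z ∈ F^c.
module Submission where

open import Defs
open import Data.Bool using (true; not)
open import Data.Bool.Properties using (not-involutive)
open import Data.Product using (_×_; _,_)
open import Relation.Binary.PropositionalEquality using (refl; sym; trans; cong)

⊆-trans : ∀ {X Y Z} → X ⊆ Y → Y ⊆ Z → X ⊆ Z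
⊆-trans X⊆Y Y⊆Z n Xn = Y⊆Z n (X⊆Y n Xn)

≐⇒⊇ : ∀ {X Y} → X ≐ Y → Y ⊆ X
≐⇒⊇ X≐Y n Yn = trans (X≐Y n) Yn

∁-cong : ∀ {X Y} → X ≐ Y → ∁ X ≐ ∁ Y
∁-cong X≐Y n = cong not (X≐Y n)

∩⊆∁⊕ : ∀ X Y → (X ∩ Y) ⊆ ∁ (X ⊕ Y)
∩⊆∁⊕ X Y n X∩Yn with X n | Y n
... | true | true = refl

X≐ω⊕∁X : ∀ X → X ≐ (ω ⊕ ∁ X)
X≐ω⊕∁X X n = sym (not-involutive (X n))

module _ {F : Subset → Set} (isFilter : IsFilter F) where
  open IsFilter isFilter

  sumSet⇒dual : ∀ Z → SumSet F Z → Dual F Z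
  sumSet⇒dual Z (X , Y , X∈F , Y∈F , Z≐X⊕Y) =
    upward (X ∩ Y) (∁ Z) (⊆-trans (∩⊆∁⊕ X Y) (≐⇒⊇ (∁-cong Z≐X⊕Y)))
      (intersect X Y X∈F Y∈F)

  dual⇒sumSet : ∀ Z → Dual F Z → SumSet F Z
  dual⇒sumSet Z ∁Z∈F = ω , ∁ Z , has-ω , ∁Z∈F , X≐ω⊕∁X Z

lemma1p5 : (F : Subset → Set) → IsFilter F → NonPrincipal F →
    (∀ Z → SumSet F Z → Dual F Z) × (∀ Z → Dual F Z → SumSet F Z)
lemma1p5 F isFilter _ = sumSet⇒dual isFilter , dual⇒sumSet isFilter
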